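{- Let $P=B_1/\cdots/B_k$ be a merging-free partition of $[n]$, let $\pi$ be the run-sorted permutation obtained by flattening $P$, and let $f$ be the canonical form of $P$. Then $\operatorname{Rlmin}(\pi)=\operatorname{LwMp}(f)$.
   Context: Block representation: blocks ordered by increasing minima, elements in each block increasing. $P$ is merging-free if $\max B_i>\min B_{i+1}$ for $1\le i\le k-1$. Flattening $P$ means concatenating $B_1,B_2,\dots,B_k$ (each in increasing order) to get a permutation $\pi=\pi(1)\cdots\pi(n)$. The canonical form of $P$ is $f=f_1\cdots f_n$ with $j\in B_{f_j}$. $\operatorname{Rlmin}(\pi)=\{\pi(i): \pi(i)<\pi(j)\text{ for all } j>i\}$ (set of right-to-left minimum values). $\operatorname{LwMp}(f)=\{i\in[n]: f_i\ge f_j \text{ for all } j<i\}$. -}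

module Defs where

open import Data.Nat using (ℕ; suc; _+_; _<_; _≤_)
open import Data.Fin as Fin using (Fin; toℕ)
open import Data.List using (List; []; _∷_; length; lookup; concat; map; upTo; head; last)
open import Data.List.Relation.Unary.All using (All)
open import Data.List.Relation.Unary.Linked using (Linked)
open import Data.List.Relation.Binary.Permutation.Propositional using (_↭_)
open import Data.List.Membership.Propositional using (_∈_)
open import Data.Maybe using (just)
open import Data.Product using (Σ; ∃; _×_)
open import Relation.Binary.PropositionalEquality using (_≡_)

Blocks : Set
Blocks = List (List ℕ)

range : ℕ → List ℕ
range n = map suc (upTo n)

NonEmpty : List ℕ → Set
NonEmpty B = ∃ λ x → head B ≡ just x

-- min B < min C (blocks nonempty, increasing, so min = head)
MinLt : List ℕ → List ℕ → Set
MinLt B C = ∃ λ x → ∃ λ y → head B ≡ just x × head C ≡ just y × x < y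

IsPartitionOf : ℕ → Blocks → Set
IsPartitionOf n P =
  All NonEmpty P × All (Linked _<_) P × Linked MinLt P × (concat P ↭ range n)

-- max B > min C  (max B = last B since B is increasing)
MaxGtMin : List ℕ → List ℕ → Set
MaxGtMin B C = ∃ λ x → ∃ λ y → last B ≡ just x × head C ≡ just y × y < x

MergingFree : Blocks → Set
MergingFree P = Linked MaxGtMin P

flatten : Blocks → List ℕ
flatten = concat

-- f = f_1 ⋯ f_n is the canonical form of P: length n and, for each
-- position j (1-based), j ∈ B_{f_j} (blocks indexed from 1).
IsCanonicalForm : ℕ → Blocks → List ℕ → Set
IsCanonicalForm n P f =
  (length f ≡ n) ×
  ((j : Fin (length f)) →
     Σ (Fin (length P)) λ b → (toℕ b + 1 ≡ lookup f j) × (toℕ j + 1 ∈ lookup P b))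

Rlmin : List ℕ → ℕ → Set
Rlmin π x = Σ (Fin (length π)) λ i →
  (lookup π i ≡ x) × ((j : Fin (length π)) → i Fin.< j → lookup π i < lookup π j)

LwMp : List ℕ → ℕ → Set
LwMp f i = Σ (Fin (length f)) λ p →
  (toℕ p + 1 ≡ i) × ((q : Fin (length f)) → q Fin.< p → lookup f q ≤ lookup f p)

-- Write β(y) for the block containing y. Both sets equal the set of x such
-- that every block after β(x) consists of elements larger than x. For Rlmin
-- this is because the entries of π after x are the rest of β(x), which is
-- larger than x anyway, followed by the later blocks. For LwMp, since
-- f_q = β(q), the condition f_q ≤ f_x for all q < x says that no element
-- smaller than x lies in a block after β(x).
module Submission where

open import Defs
open import Data.Nat using (ℕ; _+_; _<_; _≤_; z≤n; s≤s; _≤?_)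
open import Data.Nat.Properties
  using (<-trans; <-asym; <⇒≱; ≰⇒>; +-comm; +-monoˡ-≤; +-monoˡ-<; +-cancelʳ-≤; +-cancelʳ-<
        ; suc-injective)
open import Data.Fin as Fin using (Fin; toℕ; fromℕ<)
open import Data.Fin.Properties using (toℕ-fromℕ<; <-cmp; <⇒≢)
open import Data.List using (List; []; _∷_; _++_; length; lookup; concat)
open import Data.List.Properties using (∷-injective; ++-assoc)
open import Data.List.Relation.Unary.All as All using (All; []; _∷_)
open import Data.List.Relation.Unary.All.Properties using (++⁺; ++⁻ʳ; concat⁺; concat⁻)
open import Data.List.Relation.Unary.Any using (here; there; index)
open import Data.List.Relation.Unary.Any.Properties using (lookup-index)
open import Data.List.Relation.Unary.AllPairs using (AllPairs; _∷_)
open import Data.List.Relation.Unary.Linked using (Linked)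
open import Data.List.Relation.Unary.Linked.Properties using (Linked⇒AllPairs)
open import Data.List.Relation.Unary.Unique.Propositional using (Unique)
import Data.List.Relation.Unary.Unique.Propositional.Properties as Unique
open import Data.List.Relation.Binary.Permutation.Propositional using (_↭_; ↭-sym; ↭⇒↭ₛ)
open import Data.List.Relation.Binary.Permutation.Propositional.Properties using (∈-resp-↭)
import Data.List.Relation.Binary.Permutation.Setoid.Properties as Permutation
open import Data.List.Membership.Propositional using (_∈_)
open import Data.List.Membership.Propositional.Properties
  using (∈-∃++; ∈-concat⁺′; ∈-lookup; ∈-map⁻; ∈-upTo⁻)
open import Data.Product using (Σ; ∃; ∃₂; _×_; _,_; proj₁; proj₂)
open import Data.Sum using (_⊎_; inj₁; inj₂)
open import Data.Empty using (⊥; ⊥-elim)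
open import Function using (_∘_)
open import Relation.Nullary using (yes; no)
open import Relation.Binary.Definitions using (tri<; tri≈; tri>)
open import Relation.Binary.PropositionalEquality

private
  variable
    A : Set

All-tabulate-lookup : ∀ {P : A → Set} (xs : List A) →
  ((i : Fin (length xs)) → P (lookup xs i)) → All P xs
All-tabulate-lookup {P = P} xs h =
  All.tabulate λ x∈xs → subst P (sym (lookup-index x∈xs)) (h (index x∈xs))

AllPairs-++-∷⇒All : ∀ {R : A → A → Set} ys {x zs} → AllPairs R (ys ++ x ∷ zs) → All (R x) zs
AllPairs-++-∷⇒All []       (Rxzs ∷ _) = Rxzs
AllPairs-++-∷⇒All (_ ∷ ys) (_ ∷ rest) = AllPairs-++-∷⇒All ys rest

++-≡-++-∷ : ∀ (xs ys us vs : List A) {x} → xs ++ ys ≡ us ++ x ∷ vs →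
  (∃ λ ws → x ∈ xs × vs ≡ ws ++ ys) ⊎ (∃ λ us′ → ys ≡ us′ ++ x ∷ vs)
++-≡-++-∷ []       ys us       vs eq = inj₂ (us , eq)
++-≡-++-∷ (_ ∷ xs) ys []       vs eq with refl , eq′ ← ∷-injective eq =
  inj₁ (xs , here refl , sym eq′)
++-≡-++-∷ (_ ∷ xs) ys (_ ∷ us) vs eq with ++-≡-++-∷ xs ys us vs (proj₂ (∷-injective eq))
... | inj₁ (ws , x∈xs , vs≡) = inj₁ (ws , there x∈xs , vs≡)
... | inj₂ split             = inj₂ split

Unique-++⇒disjoint : ∀ (xs : List A) {ys y} → Unique (xs ++ ys) → y ∈ xs → y ∈ ys → ⊥
Unique-++⇒disjoint (_ ∷ xs) (x∉ ∷ _) (here refl) y∈ys = All.lookup (++⁻ʳ xs x∉) y∈ys refl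
Unique-++⇒disjoint (_ ∷ xs) (_ ∷ u)  (there y∈xs) y∈ys = Unique-++⇒disjoint xs u y∈xs y∈ys

Unique-++⇒Uniqueʳ : ∀ (xs : List A) {ys} → Unique (xs ++ ys) → Unique ys
Unique-++⇒Uniqueʳ []       u       = u
Unique-++⇒Uniqueʳ (_ ∷ xs) (_ ∷ u) = Unique-++⇒Uniqueʳ xs u

FollowedByLarger : List ℕ → ℕ → Set
FollowedByLarger π x = ∃₂ λ ys zs → (π ≡ ys ++ x ∷ zs) × All (x <_) zs

Rlmin⇒FollowedByLarger : ∀ π {x} → Rlmin π x → FollowedByLarger π x
Rlmin⇒FollowedByLarger (_ ∷ π) (Fin.zero , refl , min) =
  [] , π , refl , All-tabulate-lookup π (λ j → min (Fin.suc j) (s≤s z≤n))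
Rlmin⇒FollowedByLarger (a ∷ π) (Fin.suc i , refl , min)
  with ys , zs , eq , larger ←
    Rlmin⇒FollowedByLarger π (i , refl , λ j i<j → min (Fin.suc j) (s≤s i<j))
  = a ∷ ys , zs , cong (a ∷_) eq , larger

FollowedByLarger⇒Rlmin : ∀ {π x} → FollowedByLarger π x → Rlmin π x
FollowedByLarger⇒Rlmin (ys , _ , refl , larger) = Rlmin-++-∷ ys larger
  where
  Rlmin-++-∷ : ∀ ys {x zs} → All (x <_) zs → Rlmin (ys ++ x ∷ zs) x
  Rlmin-++-∷ [] {x} {zs} larger = Fin.zero , refl , min
    where
    min : (j : Fin (length (x ∷ zs))) → Fin.zero {n = length zs} Fin.< j → x < lookup (x ∷ zs) j
    min (Fin.suc j) _ = All.lookup larger (∈-lookup j)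
  Rlmin-++-∷ (y ∷ ys) larger with i , πi≡x , min ← Rlmin-++-∷ ys larger
    = Fin.suc i , πi≡x , λ { (Fin.suc j) (s≤s i<j) → min j i<j }

LaterBlocksExceed : Blocks → ℕ → Set
LaterBlocksExceed P x = Σ (Fin (length P)) λ b → (x ∈ lookup P b) ×
  ((b′ : Fin (length P)) → b Fin.< b′ → All (x <_) (lookup P b′))

FollowedByLarger-concat⇒LaterBlocksExceed : ∀ P {x} →
  FollowedByLarger (concat P) x → LaterBlocksExceed P x
FollowedByLarger-concat⇒LaterBlocksExceed [] ([]    , _ , () , _)
FollowedByLarger-concat⇒LaterBlocksExceed [] (_ ∷ _ , _ , () , _)
FollowedByLarger-concat⇒LaterBlocksExceed (B ∷ P) (ys , zs , eq , larger)
  with ++-≡-++-∷ B (concat P) ys zs eq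
... | inj₁ (ws , x∈B , refl) = Fin.zero , x∈B , λ
  { (Fin.suc b′) _ → All.lookup (concat⁻ {xss = P} (++⁻ʳ ws larger)) (∈-lookup {xs = P} b′) }
... | inj₂ (ys′ , eq′)
  with b , x∈ , later ← FollowedByLarger-concat⇒LaterBlocksExceed P (ys′ , zs , eq′ , larger)
  = Fin.suc b , x∈ , λ { (Fin.suc b′) (s≤s b<b′) → later b′ b<b′ }

LaterBlocksExceed⇒FollowedByLarger-concat : ∀ P {x} → All (Linked _<_) P →
  LaterBlocksExceed P x → FollowedByLarger (concat P) x
LaterBlocksExceed⇒FollowedByLarger-concat (B ∷ P) (B↑ ∷ _) (Fin.zero , x∈B , later)
  with bs , cs , refl ← ∈-∃++ x∈B
  = bs , cs ++ concat P , ++-assoc bs (_ ∷ cs) (concat P) ,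
    ++⁺ (AllPairs-++-∷⇒All bs (Linked⇒AllPairs <-trans B↑))
        (concat⁺ (All-tabulate-lookup P (λ b′ → later (Fin.suc b′) (s≤s z≤n))))
LaterBlocksExceed⇒FollowedByLarger-concat (B ∷ P) (_ ∷ P↑) (Fin.suc b , x∈ , later)
  with ys , zs , eq , larger ←
    LaterBlocksExceed⇒FollowedByLarger-concat P P↑
      (b , x∈ , λ b′ b<b′ → later (Fin.suc b′) (s≤s b<b′))
  = B ++ ys , zs , trans (cong (B ++_) eq) (sym (++-assoc B ys _)) , larger

∈-range⁻ : ∀ {n y} → y ∈ range n → ∃ λ k → k < n × k + 1 ≡ y
∈-range⁻ y∈ with k , k∈ , refl ← ∈-map⁻ _ y∈ = k , ∈-upTo⁻ k∈ , +-comm k 1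

↭-range⇒Unique : ∀ {xs} n → xs ↭ range n → Unique xs
↭-range⇒Unique n xs↭ =
  Permutation.Unique-resp-↭ (setoid ℕ) (↭⇒↭ₛ (↭-sym xs↭))
    (Unique.map⁺ suc-injective (Unique.upTo⁺ n))

∈-block⇒∈-concat : ∀ (P : Blocks) b {y} → y ∈ lookup P b → y ∈ concat P
∈-block⇒∈-concat P b y∈ = ∈-concat⁺′ y∈ (∈-lookup {xs = P} b)

block-unique : ∀ (P : Blocks) → Unique (concat P) → ∀ b b′ {y} →
  y ∈ lookup P b → y ∈ lookup P b′ → b ≡ b′
block-unique (B ∷ P) u Fin.zero    Fin.zero     _  _   = refl
block-unique (B ∷ P) u Fin.zero    (Fin.suc b′) y∈ y∈′ =
  ⊥-elim (Unique-++⇒disjoint B u y∈ (∈-block⇒∈-concat P b′ y∈′))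
block-unique (B ∷ P) u (Fin.suc b) Fin.zero     y∈ y∈′ =
  ⊥-elim (Unique-++⇒disjoint B u y∈′ (∈-block⇒∈-concat P b y∈))
block-unique (B ∷ P) u (Fin.suc b) (Fin.suc b′) y∈ y∈′ =
  cong Fin.suc (block-unique P (Unique-++⇒Uniqueʳ B u) b b′ y∈ y∈′)

module CanonicalForm (n : ℕ) (P : Blocks) (f : List ℕ)
  (P↭ : concat P ↭ range n)
  (len : length f ≡ n)
  (canonical : (j : Fin (length f)) →
     Σ (Fin (length P)) λ b → (toℕ b + 1 ≡ lookup f j) × (toℕ j + 1 ∈ lookup P b)) where

  blockOf : Fin (length f) → Fin (length P)
  blockOf q = proj₁ (canonical q)

  blockOf-lookup : ∀ q → toℕ (blockOf q) + 1 ≡ lookup f q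
  blockOf-lookup q = proj₁ (proj₂ (canonical q))

  ∈-blockOf : ∀ q → toℕ q + 1 ∈ lookup P (blockOf q)
  ∈-blockOf q = proj₂ (proj₂ (canonical q))

  blockOf-unique : ∀ q {b} → toℕ q + 1 ∈ lookup P b → blockOf q ≡ b
  blockOf-unique q = block-unique P (↭-range⇒Unique n P↭) _ _ (∈-blockOf q)

  lookup-≤⇒blockOf-≤ : ∀ q p → lookup f q ≤ lookup f p → blockOf q Fin.≤ blockOf p
  lookup-≤⇒blockOf-≤ q p fq≤fp =
    +-cancelʳ-≤ 1 _ _ (subst₂ _≤_ (sym (blockOf-lookup q)) (sym (blockOf-lookup p)) fq≤fp)

  blockOf-≤⇒lookup-≤ : ∀ q p → blockOf q Fin.≤ blockOf p → lookup f q ≤ lookup f p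
  blockOf-≤⇒lookup-≤ q p βq≤βp =
    subst₂ _≤_ (blockOf-lookup q) (blockOf-lookup p) (+-monoˡ-≤ 1 βq≤βp)

  position : ∀ {y} → y ∈ concat P → Σ (Fin (length f)) λ q → toℕ q + 1 ≡ y
  position y∈ with k , k<n , refl ← ∈-range⁻ (∈-resp-↭ P↭ y∈) =
    fromℕ< (subst (k <_) (sym len) k<n) , cong (_+ 1) (toℕ-fromℕ< _)

  LwMp⇒LaterBlocksExceed : ∀ {x} → LwMp f x → LaterBlocksExceed P x
  LwMp⇒LaterBlocksExceed (p , refl , weakMax) = blockOf p , ∈-blockOf p , later
    where
    exceeds : ∀ b′ → blockOf p Fin.< b′ → ∀ {y} → y ∈ lookup P b′ → toℕ p + 1 < y
    exceeds b′ βp<b′ y∈ with q , refl ← position (∈-block⇒∈-concat P b′ y∈)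
      with blockOf-unique q y∈ | <-cmp p q
    ... | _     | tri< p<q _ _ = +-monoˡ-< 1 p<q
    ... | βq≡b′ | tri≈ _ refl _ = ⊥-elim (<⇒≢ βp<b′ βq≡b′)
    ... | refl  | tri> _ _ q<p = ⊥-elim (<⇒≱ βp<b′ (lookup-≤⇒blockOf-≤ q p (weakMax q q<p)))

    later : ∀ b′ → blockOf p Fin.< b′ → All (toℕ p + 1 <_) (lookup P b′)
    later b′ βp<b′ = All.tabulate (exceeds b′ βp<b′)

  LaterBlocksExceed⇒LwMp : ∀ {x} → LaterBlocksExceed P x → LwMp f x
  LaterBlocksExceed⇒LwMp (b , x∈ , later)
    with p , refl ← position (∈-block⇒∈-concat P b x∈) | blockOf-unique p x∈
  ... | refl = p , refl , weakMax
    where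
    weakMax : ∀ q → q Fin.< p → lookup f q ≤ lookup f p
    weakMax q q<p with toℕ (blockOf q) ≤? toℕ (blockOf p)
    ... | yes βq≤βp = blockOf-≤⇒lookup-≤ q p βq≤βp
    ... | no βq≰βp  =
      ⊥-elim (<-asym q<p (+-cancelʳ-< 1 _ _
        (All.lookup (later (blockOf q) (≰⇒> βq≰βp)) (∈-blockOf q))))

proposition25 : (n : ℕ) (P : Blocks) (f : List ℕ) →
    IsPartitionOf n P → MergingFree P → IsCanonicalForm n P f →
    (x : ℕ) → (Rlmin (flatten P) x → LwMp f x) × (LwMp f x → Rlmin (flatten P) x)
proposition25 n P f (_ , increasing , _ , P↭) _ (len , canonical) _ =
  LaterBlocksExceed⇒LwMp
    ∘ FollowedByLarger-concat⇒LaterBlocksExceed P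
    ∘ Rlmin⇒FollowedByLarger (concat P) ,
  FollowedByLarger⇒Rlmin
    ∘ LaterBlocksExceed⇒FollowedByLarger-concat P increasing
    ∘ LwMp⇒LaterBlocksExceed
  where open CanonicalForm n P f P↭ len canonical
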